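{- Let $U$ be a tree topology and $f$ a frequency vector with $\sum_{u\in U}f_u=1$, and let $i\in U$ with $f_i>0$. Then in every STT $T$ over $U$ that minimizes $\mathrm{cost}(T,f)$, $\mathrm{depth}_T(i)\le\frac{1}{f_i}$.
   Context: An STT $T$ over a tree $U$ is defined recursively: pick a node $r$ as root; the subtrees of $r$ are STTs built recursively over the connected components of $U\setminus\{r\}$. $\mathrm{depth}_T(v)$ is the number of nodes on the path from $v$ to the root of $T$ inclusive (the root has depth $1$), and $\mathrm{cost}(T,f)=\sum_{v\in U}f_v\,\mathrm{depth}_T(v)$ for a nonnegative frequency vector $f$.
   Formalization: The frequency vector f takes values in the rationals. -}

module Defs where

open import Data.Nat using (ℕ; zero; suc; _≤_)
open import Data.Fin using (Fin; zero; suc; _≟_)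
open import Data.Fin.Subset using (Subset; _∈_; _∉_; _-_; _∩_; Nonempty; Empty; ⊤)
open import Data.Fin.Subset.Properties using (_∈?_)
open import Data.List using (List; []; _∷_; map; length; _∷ʳ_)
open import Data.List.Relation.Unary.All using (All)
open import Data.List.Relation.Unary.Any using (Any)
open import Data.List.Relation.Unary.AllPairs using (AllPairs)
open import Data.List.Relation.Unary.Unique.Propositional using (Unique)
open import Data.List.Relation.Unary.Linked using (Linked)
open import Data.Product using (Σ; _,_; proj₁; _×_; ∃)
open import Relation.Nullary using (¬_; does)
open import Relation.Binary.PropositionalEquality using (_≡_)
open import Data.Bool using (if_then_else_)
open import Data.Rational using (ℚ; 0ℚ; _+_; _*_) renaming (_/_ to _÷_)
open import Data.Integer using (+_)

module _ {n : ℕ} (Adj : Fin n → Fin n → Set) where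

  data Walk (S : Subset n) : Fin n → Fin n → Set where
    here : ∀ {u} → u ∈ S → Walk S u u
    step : ∀ {u w v} → u ∈ S → Adj u w → Walk S w v → Walk S u v

  Connected : Subset n → Set
  Connected S = ∀ {u v} → u ∈ S → v ∈ S → Walk S u v

  Acyclic : Set
  Acyclic = ∀ (u : Fin n) (xs : List (Fin n)) → 2 ≤ length xs →
            Unique (u ∷ xs) → ¬ Linked Adj ((u ∷ xs) ∷ʳ u)

  record IsTree : Set where
    field
      sym     : ∀ {u v} → Adj u v → Adj v u
      irrefl  : ∀ {u} → ¬ Adj u u
      conn    : Connected ⊤
      acyclic : Acyclic

  IsComponent : Subset n → Subset n → Set
  IsComponent C S =
    Nonempty C × (∀ {v} → v ∈ C → v ∈ S) × Connected C ×
    (∀ {u w} → u ∈ C → w ∈ S → Adj u w → w ∈ C)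

  Disjoint : Subset n → Subset n → Set
  Disjoint p q = Empty (p ∩ q)

  AreComponents : Subset n → List (Subset n) → Set
  AreComponents S Cs =
    All (λ C → IsComponent C S) Cs ×
    (∀ {v} → v ∈ S → Any (v ∈_) Cs) ×
    AllPairs Disjoint Cs

  -- search tree on trees over the vertex set S: a root r ∈ S whose
  -- subtrees are STTs over the connected components of S ∖ {r}
  data STT (S : Subset n) : Set where
    node : (r : Fin n) → r ∈ S → (cs : List (Σ (Subset n) STT)) →
           AreComponents (S - r) (map proj₁ cs) → STT S

  -- depth (root has depth 1); vertices outside S get 0
  mutual
    depth : ∀ {S} → STT S → Fin n → ℕ
    depth (node r _ cs _) v =
      if does (v ≟ r) then 1 else suc (depthL cs v)

    depthL : List (Σ (Subset n) STT) → Fin n → ℕ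
    depthL [] v = 0
    depthL ((C , t) ∷ cs) v =
      if does (v ∈? C) then depth t v else depthL cs v

Σᵥ : ∀ {n} → (Fin n → ℚ) → ℚ
Σᵥ {zero} g = 0ℚ
Σᵥ {suc n} g = g zero + Σᵥ (λ i → g (suc i))

ℕ→ℚ : ℕ → ℚ
ℕ→ℚ d = (+ d) ÷ 1

cost : ∀ {n} (Adj : Fin n → Fin n → Set) {S} → STT Adj S → (Fin n → ℚ) → ℚ
cost Adj T f = Σᵥ (λ v → f v * ℕ→ℚ (depth Adj T v))

-- Deleting i from an STT T and restricting T to the components of U ∖ {i}
-- gives STTs over those components in which no vertex is deeper than in T:
-- a root outside the restricted set is simply skipped, and a root inside it
-- becomes the root of the component it lies in.  Hanging these trees below i
-- yields an STT T′ with depth i = 1 and every other depth grown by at most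
-- one, so cost(T′) ≤ cost(T) + Σ f − f_i·depth_T(i).  If T is optimal, this
-- forces f_i·depth_T(i) ≤ Σ f = 1.
module Submission where

open import Defs
open import Data.Nat using (ℕ)
open import Data.Fin using (Fin)
open import Data.Fin.Subset using (⊤)
open import Data.Rational using (ℚ; 0ℚ; 1ℚ; _≤_; _<_; 1/_; positive)
open import Data.Rational.Properties using (pos⇒nonZero)
open import Relation.Binary.PropositionalEquality using (_≡_)

open import Algebra.Bundles using (CommutativeMonoid)
import Algebra.Properties.CommutativeSemigroup as CommSemigroupProperties
open import Data.Bool using (if_then_else_)
open import Data.Fin using (zero; suc; _≟_)
open import Data.Fin.Properties using (any?; suc-injective)
open import Data.Fin.Subset
  using (Subset; _∈_; _∉_; _-_; _─_; _∩_; _∪_; ⋃; ⁅_⁆; _⊆_; outside)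
open import Data.Fin.Subset.Properties
  using ( _∈?_; ∉⊥; ∈⊤; x∈⁅x⁆; x∈⁅y⁆⇒x≡y; x∈p∪q⁻; x∈p∪q⁺; x∈p∩q⁻; x∈p∩q⁺
        ; x∈p∧x∉q⇒x∈p─q; x∈p∧x≢y⇒x∈p-y; p─q⊆p)
import Data.Integer as ℤ
import Data.Integer.Properties as ℤₚ
open import Data.List using (List; []; _∷_; map; _++_; _∷ʳ_; filter)
open import Data.List.Properties using (map-++)
open import Data.List.Membership.Propositional using () renaming (_∈_ to _∈ₗ_)
import Data.List.Relation.Unary.All as All
open All using (All; []; _∷_)
import Data.List.Relation.Unary.All.Properties as Allₚ
open import Data.List.Relation.Unary.Any using (Any; here; there)
import Data.List.Relation.Unary.Any.Properties as Anyₚ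
open import Data.List.Relation.Unary.AllPairs as AllPairs using (AllPairs; []; _∷_)
import Data.List.Relation.Unary.AllPairs.Properties as AllPairsₚ
open import Data.List.Relation.Unary.Linked as Linked using (Linked; [-]; _∷_)
open import Data.List.Relation.Unary.Unique.Propositional using (Unique)
open import Data.Nat as ℕ using (zero; suc)
import Data.Nat.Properties as ℕₚ
import Data.Nat.Coprimality as Coprimality
open import Data.Product using (Σ; ∃; _×_; _,_; proj₁; proj₂)
open import Data.Rational using (mkℚ; _+_; _*_; -_; _/_; nonNegative)
open import Data.Rational.Properties
  using ( ≤-refl; +-mono-≤; +-monoˡ-≤; +-monoʳ-≤; *-monoˡ-≤-nonNeg
        ; +-assoc; +-identityˡ; +-identityʳ; +-inverseˡ; +-0-commutativeMonoid
        ; *-zeroʳ; *-identityʳ; *-distribˡ-+; *-inverseʳ; *-cancelˡ-≤-pos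
        ; normalize-coprime; nonNegative⁻¹; normalize-nonNeg; module ≤-Reasoning)
import Data.Vec.Base as Vec
open import Data.Sum using (_⊎_; inj₁; inj₂)
import Data.Sum as Sum
open import Function using (_∘_)
open import Relation.Nullary using (¬_; Dec; yes; no; does; contradiction; ¬?)
open import Relation.Nullary.Decidable using (dec-true; dec-false; _×-dec_)
open import Relation.Unary using (Decidable)
open import Relation.Binary.PropositionalEquality
  using (_≢_; refl; sym; trans; cong; cong₂; subst; subst₂)

x∈p─q⇒x∉q : ∀ {n} {x : Fin n} {p q : Subset n} → x ∈ p ─ q → x ∉ q
x∈p─q⇒x∉q {p = _ Vec.∷ _} {outside Vec.∷ _} Vec.here ()
x∈p─q⇒x∉q {p = _ Vec.∷ _} {_ Vec.∷ _} (Vec.there x∈p─q) (Vec.there x∈q) =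
  x∈p─q⇒x∉q x∈p─q x∈q

x∈p-y⇒x≢y : ∀ {n} {x y : Fin n} {p : Subset n} → x ∈ p - y → x ≢ y
x∈p-y⇒x≢y x∈p-y refl = x∈p─q⇒x∉q x∈p-y (x∈⁅x⁆ _)

p⊆q⇒p-x⊆q-x : ∀ {n} {x : Fin n} {p q : Subset n} → p ⊆ q → p - x ⊆ q - x
p⊆q⇒p-x⊆q-x p⊆q y∈p-x = x∈p∧x≢y⇒x∈p-y (p⊆q (p─q⊆p _ _ y∈p-x)) (x∈p-y⇒x≢y y∈p-x)

x∈⋃⁻ : ∀ {n} {x : Fin n} (ps : List (Subset n)) → x ∈ ⋃ ps → Any (x ∈_) ps
x∈⋃⁻ []       x∈⋃ = contradiction x∈⋃ ∉⊥
x∈⋃⁻ (p ∷ ps) x∈⋃ with x∈p∪q⁻ p (⋃ ps) x∈⋃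
... | inj₁ x∈p  = here x∈p
... | inj₂ x∈ps = there (x∈⋃⁻ ps x∈ps)

x∈⋃⁺ : ∀ {n} {x : Fin n} {ps : List (Subset n)} → Any (x ∈_) ps → x ∈ ⋃ ps
x∈⋃⁺ (here x∈p)  = x∈p∪q⁺ (inj₁ x∈p)
x∈⋃⁺ (there x∈ps) = x∈p∪q⁺ (inj₂ (x∈⋃⁺ x∈ps))

p⊆⋃ : ∀ {n} (ps : List (Subset n)) → All (_⊆ ⋃ ps) ps
p⊆⋃ []       = []
p⊆⋃ (p ∷ ps) =
  (λ x∈p → x∈p∪q⁺ (inj₁ x∈p)) ∷ All.map (λ q⊆ {_} x∈q → x∈p∪q⁺ (inj₂ (q⊆ x∈q))) (p⊆⋃ ps)

Any-filter-⊎ : ∀ {a p q} {A : Set a} {P : A → Set p} {Q : A → Set q} (Q? : Decidable Q) {xs} →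
               Any P xs → Any P (filter Q? xs) ⊎ Any P (filter (¬? ∘ Q?) xs)
Any-filter-⊎ Q? p with Anyₚ.filter⁺ Q? p
... | inj₁ p-Q = inj₁ p-Q
... | inj₂ ¬Q with Anyₚ.filter⁺ (¬? ∘ Q?) p
...   | inj₁ p-¬Q = inj₂ p-¬Q
...   | inj₂ ¬¬Q  = contradiction ¬Q ¬¬Q

module Walks {n : ℕ} (Adj : Fin n → Fin n → Set) where

  walk-start : ∀ {S u v} → Walk Adj S u v → u ∈ S
  walk-start (here u∈S)     = u∈S
  walk-start (step u∈S _ _) = u∈S

  Walk-⊆ : ∀ {S S′ u v} → S ⊆ S′ → Walk Adj S u v → Walk Adj S′ u v
  Walk-⊆ S⊆S′ (here u∈S)       = here (S⊆S′ u∈S)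
  Walk-⊆ S⊆S′ (step u∈S u~w w) = step (S⊆S′ u∈S) u~w (Walk-⊆ S⊆S′ w)

  _++ʷ_ : ∀ {S u v w} → Walk Adj S u v → Walk Adj S v w → Walk Adj S u w
  here _         ++ʷ w′ = w′
  step u∈S u~x w ++ʷ w′ = step u∈S u~x (w ++ʷ w′)

  reverseʷ : (∀ {u v} → Adj u v → Adj v u) → ∀ {S u v} → Walk Adj S u v → Walk Adj S v u
  reverseʷ adj-sym (here u∈S)       = here u∈S
  reverseʷ adj-sym (step u∈S u~x w) =
    reverseʷ adj-sym w ++ʷ step (walk-start w) (adj-sym u~x) (here u∈S)

  Closed : Subset n → Subset n → Set
  Closed K S = ∀ {u w} → u ∈ K → w ∈ S → Adj u w → w ∈ K

  Closed-⊆ : ∀ {K S W} → Closed K S → W ⊆ S → Closed K W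
  Closed-⊆ K-closed W⊆S u∈K w∈W = K-closed u∈K (W⊆S w∈W)

  Closed-walk : ∀ {K S W} → Closed K S → W ⊆ S → ∀ {u v} → Walk Adj W u v → u ∈ K → v ∈ K
  Closed-walk K-closed W⊆S (here _)         u∈K = u∈K
  Closed-walk K-closed W⊆S (step _ u~x w) u∈K =
    Closed-walk K-closed W⊆S w (K-closed u∈K (W⊆S (walk-start w)) u~x)

  component⇒⊆ : ∀ {K S} → IsComponent Adj K S → K ⊆ S
  component⇒⊆ (_ , K⊆S , _ , _) = K⊆S

  component⇒connected : ∀ {K S} → IsComponent Adj K S → Connected Adj K
  component⇒connected (_ , _ , K-connected , _) = K-connected

  component⇒closed : ∀ {K S} → IsComponent Adj K S → Closed K S
  component⇒closed (_ , _ , _ , K-closed) = K-closed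

  All-Closed-⊆ : ∀ {S W Ks} → W ⊆ S → All (λ K → Closed K S) Ks → All (λ K → Closed K W) Ks
  All-Closed-⊆ {S} {W} W⊆S =
    All.map {P = λ K → Closed K S} {Q = λ K → Closed K W} (λ K-closed → Closed-⊆ K-closed W⊆S)

  All-component⇒closed : ∀ {S Ks} → All (λ K → IsComponent Adj K S) Ks → All (λ K → Closed K S) Ks
  All-component⇒closed {S} = All.map {Q = λ K → Closed K S} component⇒closed

  component-⊆ : ∀ {K K′ S v} → IsComponent Adj K S → IsComponent Adj K′ S →
                v ∈ K → v ∈ K′ → K ⊆ K′
  component-⊆ K-comp K′-comp v∈K v∈K′ u∈K =
    Closed-walk (component⇒closed K′-comp) (component⇒⊆ K-comp)
                (component⇒connected K-comp v∈K u∈K) v∈K′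

module Paths {n : ℕ} (Adj : Fin n → Fin n → Set) where

  open import Data.List.Membership.DecPropositional (_≟_ {n}) using () renaming (_∈?_ to _∈ₗ?_)

  EndsAt : Fin n → List (Fin n) → Fin n → Set
  EndsAt u []       v = u ≡ v
  EndsAt _ (x ∷ xs) v = EndsAt x xs v

  record Path (u v : Fin n) : Set where
    constructor path
    field
      rest   : List (Fin n)
      linked : Linked Adj (u ∷ rest)
      unique : Unique (u ∷ rest)
      ends   : EndsAt u rest v

  Path-suffix : ∀ {x z v} zs → x ∈ₗ z ∷ zs → Linked Adj (z ∷ zs) → Unique (z ∷ zs) →
                EndsAt z zs v → Path x v
  Path-suffix zs        (here refl)  linked unique ends = path zs linked unique ends
  Path-suffix (_ ∷ zs) (there x∈zs) linked unique ends =
    Path-suffix zs x∈zs (Linked.tail linked) (AllPairs.tail unique) ends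

  walk⇒path : ∀ {S u v} → Walk Adj S u v → Path u v
  walk⇒path (here _) = path [] [-] ([] ∷ []) refl
  walk⇒path {u = u} (step {w = w} _ u~w walk) with walk⇒path walk
  ... | path xs linked unique ends with u ∈ₗ? w ∷ xs
  ...   | yes u∈ = Path-suffix xs u∈ linked unique ends
  ...   | no u∉  = path (w ∷ xs) (u~w ∷ linked) (Allₚ.¬Any⇒All¬ _ u∉ ∷ unique) ends

  Linked-∷ʳ : ∀ {z v u} zs → Linked Adj (z ∷ zs) → EndsAt z zs v → Adj v u →
              Linked Adj ((z ∷ zs) ∷ʳ u)
  Linked-∷ʳ []       _               refl v~u = v~u ∷ [-]
  Linked-∷ʳ (_ ∷ zs) (z~z′ ∷ linked) ends v~u = z~z′ ∷ Linked-∷ʳ zs linked ends v~u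

  -- The path from u to v has a single edge iff u ~ v: a longer one closes a
  -- cycle with the edge v ~ u.
  IsTree⇒adj? : IsTree Adj → ∀ u v → Dec (Adj u v)
  IsTree⇒adj? tree u v with u ≟ v
  ... | yes refl = no (IsTree.irrefl tree)
  ... | no u≢v with walk⇒path (IsTree.conn tree ∈⊤ ∈⊤)
  ...   | path [] _ _ u≡v               = contradiction u≡v u≢v
  ...   | path (_ ∷ []) (u~x ∷ _) _ x≡v = yes (subst (Adj u) x≡v u~x)
  ...   | path xs@(_ ∷ _ ∷ _) linked unique ends =
          no λ u~v → IsTree.acyclic tree u xs (ℕ.s≤s (ℕ.s≤s ℕ.z≤n)) unique
                       (Linked-∷ʳ xs linked ends (IsTree.sym tree u~v))

module Restrictions {n : ℕ} (Adj : Fin n → Fin n → Set)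
                    (adj-sym : ∀ {u v} → Adj u v → Adj v u)
                    (adj? : ∀ u v → Dec (Adj u v)) where

  open Walks Adj

  Forest : Set
  Forest = List (Σ (Subset n) (STT Adj))

  domains : Forest → List (Subset n)
  domains = map proj₁

  root : ∀ {S} → STT Adj S → Fin n
  root (node r _ _ _) = r

  subtrees : ∀ {S} → STT Adj S → Forest
  subtrees (node _ _ ts _) = ts

  depth-root : ∀ {S} (T : STT Adj S) → depth Adj T (root T) ≡ 1
  depth-root (node r _ ts _) =
    cong (λ b → if b then 1 else suc (depthL Adj ts r)) (dec-true (r ≟ r) refl)

  depth-nonroot : ∀ {S} (T : STT Adj S) {v} → v ≢ root T →
                  depth Adj T v ≡ suc (depthL Adj (subtrees T) v)
  depth-nonroot (node r _ ts _) {v} v≢r =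
    cong (λ b → if b then 1 else suc (depthL Adj ts v)) (dec-false (v ≟ r) v≢r)

  depthL-here : ∀ {K} (t : STT Adj K) ts {v} → v ∈ K → depthL Adj ((K , t) ∷ ts) v ≡ depth Adj t v
  depthL-here {K} t ts {v} v∈K =
    cong (λ b → if b then depth Adj t v else depthL Adj ts v) (dec-true (v ∈? K) v∈K)

  depthL-there : ∀ {K} (t : STT Adj K) ts {v} → v ∉ K → depthL Adj ((K , t) ∷ ts) v ≡ depthL Adj ts v
  depthL-there {K} t ts {v} v∉K =
    cong (λ b → if b then depth Adj t v else depthL Adj ts v) (dec-false (v ∈? K) v∉K)

  depthL-++ˡ : ∀ ts us {v} → Any (v ∈_) (domains ts) → depthL Adj (ts ++ us) v ≡ depthL Adj ts v
  depthL-++ˡ ((K , t) ∷ ts) us {v} v∈ts with v ∈? K | v∈ts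
  ... | yes _   | _           = refl
  ... | no v∉K | here v∈K    = contradiction v∈K v∉K
  ... | no _   | there v∈ts′ = depthL-++ˡ ts us v∈ts′

  depthL-++ʳ : ∀ ts us {v} → All (v ∉_) (domains ts) → depthL Adj (ts ++ us) v ≡ depthL Adj us v
  depthL-++ʳ []             us []           = refl
  depthL-++ʳ ((K , t) ∷ ts) us (v∉K ∷ v∉ts) =
    trans (depthL-there t (ts ++ us) v∉K) (depthL-++ʳ ts us v∉ts)

  depthL-filter : ∀ {q} {Q : Σ (Subset n) (STT Adj) → Set q} (Q? : Decidable Q) {v} ts →
                  All (λ x → v ∈ proj₁ x → Q x) ts →
                  depthL Adj (filter Q? ts) v ≡ depthL Adj ts v
  depthL-filter Q? []             []           = refl
  depthL-filter Q? {v} ((K , t) ∷ ts) (∈⇒Q ∷ ∈⇒Qs) with Q? (K , t)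
  ... | yes _ with v ∈? K
  ...   | yes _ = refl
  ...   | no _  = depthL-filter Q? ts ∈⇒Qs
  depthL-filter Q? {v} ((K , t) ∷ ts) (∈⇒Q ∷ ∈⇒Qs) | no ¬Qt with v ∈? K
  ...   | yes v∈K = contradiction (∈⇒Q v∈K) ¬Qt
  ...   | no _    = depthL-filter Q? ts ∈⇒Qs

  record Restriction (C : Subset n) (bound : Fin n → ℕ) : Set where
    constructor restriction
    field
      forest     : Forest
      components : AreComponents Adj C (domains forest)
      depth-≤    : ∀ {v} → v ∈ C → depthL Adj forest v ℕ.≤ bound v

  restriction-mono : ∀ {C b b′} → (∀ {v} → v ∈ C → b v ℕ.≤ b′ v) →
                     Restriction C b → Restriction C b′
  restriction-mono b≤b′ (restriction ts ts-comps ≤b) =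
    restriction ts ts-comps (λ v∈C → ℕₚ.≤-trans (≤b v∈C) (b≤b′ v∈C))

  restriction-++ : ∀ {C D b₁ b₂} → Closed D C →
                   Restriction (C ∩ D) b₁ → Restriction (C ─ D) b₂ →
                   Restriction C (λ v → if does (v ∈? D) then b₁ v else b₂ v)
  restriction-++ {C} {D} {b₁} {b₂} D-closed
    (restriction ts (ts-comps , ts-cover , ts-disj) ≤b₁)
    (restriction us (us-comps , us-cover , us-disj) ≤b₂) =
    restriction (ts ++ us)
      (subst (AreComponents Adj C) (sym (map-++ proj₁ ts us))
        ( Allₚ.++⁺ (All.map inner-component ts-comps) (All.map outer-component us-comps)
        , cover
        , AllPairsₚ.++⁺ ts-disj us-disj
            (All.map (λ K-comp → All.map (separated K-comp) us-comps) ts-comps)))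
      depth-≤
    where
      ∈C∩D : ∀ {v} → v ∈ C → v ∈ D → v ∈ C ∩ D
      ∈C∩D v∈C v∈D = x∈p∩q⁺ (v∈C , v∈D)

      inner-component : ∀ {K} → IsComponent Adj K (C ∩ D) → IsComponent Adj K C
      inner-component (K≠∅ , K⊆C∩D , K-conn , K-closed) =
        K≠∅ , (λ v∈K → proj₁ (x∈p∩q⁻ C D (K⊆C∩D v∈K))) , K-conn ,
        λ u∈K w∈C u~w → K-closed u∈K
          (∈C∩D w∈C (D-closed (proj₂ (x∈p∩q⁻ C D (K⊆C∩D u∈K))) w∈C u~w)) u~w

      outer-component : ∀ {K} → IsComponent Adj K (C ─ D) → IsComponent Adj K C
      outer-component {K} (K≠∅ , K⊆C─D , K-conn , K-closed) =
        K≠∅ , (λ v∈K → p─q⊆p C D (K⊆C─D v∈K)) , K-conn , closed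
        where
          closed : Closed K C
          closed {u} {w} u∈K w∈C u~w with w ∈? D
          ... | yes w∈D = contradiction (D-closed w∈D (p─q⊆p C D (K⊆C─D u∈K)) (adj-sym u~w))
                                        (x∈p─q⇒x∉q (K⊆C─D u∈K))
          ... | no w∉D  = K-closed u∈K (x∈p∧x∉q⇒x∈p─q w∈C w∉D) u~w

      separated : ∀ {K K′} → IsComponent Adj K (C ∩ D) → IsComponent Adj K′ (C ─ D) →
                  Disjoint Adj K K′
      separated K-comp K′-comp (v , v∈K∩K′) =
        x∈p─q⇒x∉q (component⇒⊆ K′-comp (proj₂ (x∈p∩q⁻ _ _ v∈K∩K′)))
                  (proj₂ (x∈p∩q⁻ C D (component⇒⊆ K-comp (proj₁ (x∈p∩q⁻ _ _ v∈K∩K′)))))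

      cover : ∀ {v} → v ∈ C → Any (v ∈_) (domains ts ++ domains us)
      cover {v} v∈C with v ∈? D
      ... | yes v∈D = Anyₚ.++⁺ˡ (ts-cover (∈C∩D v∈C v∈D))
      ... | no v∉D  = Anyₚ.++⁺ʳ (domains ts) (us-cover (x∈p∧x∉q⇒x∈p─q v∈C v∉D))

      depth-≤ : ∀ {v} → v ∈ C → depthL Adj (ts ++ us) v ℕ.≤ (if does (v ∈? D) then b₁ v else b₂ v)
      depth-≤ {v} v∈C with v ∈? D
      ... | yes v∈D = subst (ℕ._≤ b₁ v) (sym (depthL-++ˡ ts us (ts-cover (∈C∩D v∈C v∈D))))
                            (≤b₁ (∈C∩D v∈C v∈D))
      ... | no v∉D  = subst (ℕ._≤ b₂ v) (sym (depthL-++ʳ ts us v∉ts))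
                            (≤b₂ (x∈p∧x∉q⇒x∈p─q v∈C v∉D))
        where
          v∉ts : All (v ∉_) (domains ts)
          v∉ts = All.map (λ K-comp v∈K → v∉D (proj₂ (x∈p∩q⁻ C D (component⇒⊆ K-comp v∈K))))
                         ts-comps

  -- From the components of C - r, the component Kᵣ of C containing r is
  -- rebuilt as r together with the components of C - r adjacent to r.
  module AttachRoot {C : Subset n} {r : Fin n} (r∈C : r ∈ C) {b : Fin n → ℕ}
                    (G : Restriction (C - r) b) where

    open Restriction G using () renaming (forest to gs; depth-≤ to gs-depth-≤)

    gs-components : All (λ K → IsComponent Adj K (C - r)) (domains gs)
    gs-components = proj₁ (Restriction.components G)

    gs-cover : ∀ {v} → v ∈ C - r → Any (v ∈_) (domains gs)
    gs-cover = proj₁ (proj₂ (Restriction.components G))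

    gs-disjoint : AllPairs (Disjoint Adj) (domains gs)
    gs-disjoint = proj₂ (proj₂ (Restriction.components G))

    C-r⊆C : C - r ⊆ C
    C-r⊆C = p─q⊆p C ⁅ r ⁆

    AdjacentToRoot : Subset n → Set
    AdjacentToRoot K = ∃ λ k → k ∈ K × Adj k r

    adjacentToRoot? : Decidable {A = Σ (Subset n) (STT Adj)} (AdjacentToRoot ∘ proj₁)
    adjacentToRoot? (K , _) = any? (λ k → k ∈? K ×-dec adj? k r)

    near far : Forest
    near = filter adjacentToRoot? gs
    far  = filter (¬? ∘ adjacentToRoot?) gs

    Kᵣ : Subset n
    Kᵣ = ⁅ r ⁆ ∪ ⋃ (domains near)

    NearComponent FarComponent : Subset n → Set
    NearComponent K = IsComponent Adj K (C - r) × AdjacentToRoot K × K ⊆ Kᵣ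
    FarComponent  K = IsComponent Adj K (C - r) × ¬ AdjacentToRoot K

    near-components : All NearComponent (domains near)
    near-components = All.zip
      ( Allₚ.map⁺ (Allₚ.filter⁺ adjacentToRoot? (Allₚ.map⁻ gs-components))
      , All.zip ( Allₚ.map⁺ (Allₚ.all-filter adjacentToRoot? gs)
                , All.map (λ K⊆⋃ {_} v∈K → x∈p∪q⁺ (inj₂ (K⊆⋃ v∈K))) (p⊆⋃ (domains near))))

    far-components : All FarComponent (domains far)
    far-components = Allₚ.map⁺ (All.zip
      ( Allₚ.filter⁺ (¬? ∘ adjacentToRoot?) (Allₚ.map⁻ gs-components)
      , Allₚ.all-filter (¬? ∘ adjacentToRoot?) gs))

    r∈Kᵣ : r ∈ Kᵣ
    r∈Kᵣ = x∈p∪q⁺ (inj₁ (x∈⁅x⁆ r))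

    near⊆Kᵣ : ∀ {v} → Any (v ∈_) (domains near) → v ∈ Kᵣ
    near⊆Kᵣ = x∈p∪q⁺ ∘ inj₂ ∘ x∈⋃⁺

    Kᵣ-cases : ∀ {v} → v ∈ Kᵣ → v ≡ r ⊎ ∃ λ K → NearComponent K × v ∈ K
    Kᵣ-cases v∈Kᵣ with x∈p∪q⁻ ⁅ r ⁆ (⋃ (domains near)) v∈Kᵣ
    ... | inj₁ v∈⁅r⁆ = inj₁ (x∈⁅y⁆⇒x≡y r v∈⁅r⁆)
    ... | inj₂ v∈⋃  = inj₂ (_ , All.lookupAny near-components (x∈⋃⁻ _ v∈⋃))

    near-or-far : ∀ {v} → v ∈ C - r → Any (v ∈_) (domains near) ⊎ Any (v ∈_) (domains far)
    near-or-far v∈C-r =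
      Sum.map Anyₚ.map⁺ Anyₚ.map⁺ (Any-filter-⊎ adjacentToRoot? (Anyₚ.map⁻ (gs-cover v∈C-r)))

    far-∉Kᵣ : ∀ {K v} → FarComponent K → v ∈ K → v ∉ Kᵣ
    far-∉Kᵣ (K-comp , ¬adj) v∈K v∈Kᵣ with Kᵣ-cases v∈Kᵣ
    ... | inj₁ refl = x∈p-y⇒x≢y (component⇒⊆ K-comp v∈K) refl
    ... | inj₂ (K′ , (K′-comp , (k , k∈K′ , k~r) , _) , v∈K′) =
          ¬adj (k , component-⊆ K′-comp K-comp v∈K′ v∈K k∈K′ , k~r)

    walk-to-root : ∀ {v} → v ∈ Kᵣ → Walk Adj Kᵣ v r
    walk-to-root v∈Kᵣ with Kᵣ-cases v∈Kᵣ
    ... | inj₁ refl = here r∈Kᵣ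
    ... | inj₂ (K , (K-comp , (k , k∈K , k~r) , K⊆Kᵣ) , v∈K) =
          Walk-⊆ K⊆Kᵣ (component⇒connected K-comp v∈K k∈K) ++ʷ step (K⊆Kᵣ k∈K) k~r (here r∈Kᵣ)

    Kᵣ-closed : Closed Kᵣ C
    Kᵣ-closed {u} {w} u∈Kᵣ w∈C u~w with w ≟ r
    ... | yes refl = r∈Kᵣ
    ... | no w≢r with Kᵣ-cases u∈Kᵣ | near-or-far (x∈p∧x≢y⇒x∈p-y w∈C w≢r)
    ...   | inj₂ (K , (K-comp , _ , K⊆Kᵣ) , u∈K) | _ =
            K⊆Kᵣ (component⇒closed K-comp u∈K (x∈p∧x≢y⇒x∈p-y w∈C w≢r) u~w)
    ...   | inj₁ refl | inj₁ w∈near = near⊆Kᵣ w∈near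
    ...   | inj₁ refl | inj₂ w∈far with All.lookupAny far-components w∈far
    ...     | (_ , ¬adj) , w∈K = contradiction (w , w∈K , adj-sym u~w) ¬adj

    Kᵣ⊆C : Kᵣ ⊆ C
    Kᵣ⊆C v∈Kᵣ with Kᵣ-cases v∈Kᵣ
    ... | inj₁ refl = r∈C
    ... | inj₂ (_ , (K-comp , _) , v∈K) = C-r⊆C (component⇒⊆ K-comp v∈K)

    Kᵣ-component : IsComponent Adj Kᵣ C
    Kᵣ-component =
      (r , r∈Kᵣ) , Kᵣ⊆C ,
      (λ u∈Kᵣ v∈Kᵣ → walk-to-root u∈Kᵣ ++ʷ reverseʷ adj-sym (walk-to-root v∈Kᵣ)) ,
      Kᵣ-closed

    near-component : ∀ {K} → NearComponent K → IsComponent Adj K (Kᵣ - r)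
    near-component ((K≠∅ , K⊆C-r , K-conn , K-closed) , _ , K⊆Kᵣ) =
      K≠∅ , (λ v∈K → x∈p∧x≢y⇒x∈p-y (K⊆Kᵣ v∈K) (x∈p-y⇒x≢y (K⊆C-r v∈K))) , K-conn ,
      λ u∈K w∈Kᵣ-r → K-closed u∈K (p⊆q⇒p-x⊆q-x Kᵣ⊆C w∈Kᵣ-r)

    near-cover : ∀ {v} → v ∈ Kᵣ - r → Any (v ∈_) (domains near)
    near-cover v∈Kᵣ-r with x∈p∪q⁻ ⁅ r ⁆ (⋃ (domains near)) (p─q⊆p Kᵣ ⁅ r ⁆ v∈Kᵣ-r)
    ... | inj₁ v∈⁅r⁆ = contradiction (x∈⁅y⁆⇒x≡y r v∈⁅r⁆) (x∈p-y⇒x≢y v∈Kᵣ-r)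
    ... | inj₂ v∈⋃  = x∈⋃⁻ _ v∈⋃

    far-component : ∀ {K} → FarComponent K → IsComponent Adj K C
    far-component {K} ((K≠∅ , K⊆C-r , K-conn , K-closed) , ¬adj) =
      K≠∅ , (λ v∈K → C-r⊆C (K⊆C-r v∈K)) , K-conn , closed
      where
        closed : Closed K C
        closed {u} {w} u∈K w∈C u~w with w ≟ r
        ... | yes refl = contradiction (u , u∈K , u~w) ¬adj
        ... | no w≢r   = K-closed u∈K (x∈p∧x≢y⇒x∈p-y w∈C w≢r) u~w

    disjoint-filter : ∀ {q} {Q : Σ (Subset n) (STT Adj) → Set q} (Q? : Decidable Q) →
                      AllPairs (Disjoint Adj) (domains (filter Q? gs))
    disjoint-filter Q? = AllPairsₚ.map⁺ (AllPairsₚ.filter⁺ Q? (AllPairsₚ.map⁻ gs-disjoint))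

    rootTree : STT Adj Kᵣ
    rootTree = node r r∈Kᵣ near
      (All.map near-component near-components , near-cover , disjoint-filter adjacentToRoot?)

    forest : Forest
    forest = (Kᵣ , rootTree) ∷ far

    cover : ∀ {v} → v ∈ C → Any (v ∈_) (domains forest)
    cover {v} v∈C with v ≟ r
    ... | yes refl = here r∈Kᵣ
    ... | no v≢r with near-or-far (x∈p∧x≢y⇒x∈p-y v∈C v≢r)
    ...   | inj₁ v∈near = here (near⊆Kᵣ v∈near)
    ...   | inj₂ v∈far  = there v∈far

    Kᵣ-far-disjoint : ∀ {K} → FarComponent K → Disjoint Adj Kᵣ K
    Kᵣ-far-disjoint K-far (v , v∈Kᵣ∩K) =
      far-∉Kᵣ K-far (proj₂ (x∈p∩q⁻ Kᵣ _ v∈Kᵣ∩K)) (proj₁ (x∈p∩q⁻ Kᵣ _ v∈Kᵣ∩K))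

    components : AreComponents Adj C (domains forest)
    components =
      (Kᵣ-component ∷ All.map far-component far-components) ,
      cover ,
      (All.map Kᵣ-far-disjoint far-components ∷ disjoint-filter (¬? ∘ adjacentToRoot?))

    near-depth-≤ : ∀ {v} → v ≢ r → Any (v ∈_) (domains near) → depthL Adj forest v ℕ.≤ suc (b v)
    near-depth-≤ {v} v≢r v∈near with All.lookupAny near-components v∈near
    ... | (K-comp , (k , k∈K , k~r) , _) , v∈K = begin
      depthL Adj forest v      ≡⟨ depthL-here rootTree far (near⊆Kᵣ v∈near) ⟩
      depth Adj rootTree v     ≡⟨ depth-nonroot rootTree v≢r ⟩
      suc (depthL Adj near v)  ≡⟨ cong suc (depthL-filter adjacentToRoot? gs
                                             (All.map adjacent (Allₚ.map⁻ gs-components))) ⟩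
      suc (depthL Adj gs v)    ≤⟨ ℕ.s≤s (gs-depth-≤ (component⇒⊆ K-comp v∈K)) ⟩
      suc (b v)                ∎
      where
        open ℕₚ.≤-Reasoning
        adjacent : ∀ {K′} → IsComponent Adj K′ (C - r) → v ∈ K′ → AdjacentToRoot K′
        adjacent K′-comp v∈K′ = k , component-⊆ K-comp K′-comp v∈K v∈K′ k∈K , k~r

    far-depth-≤ : ∀ {v} → Any (v ∈_) (domains far) → depthL Adj forest v ℕ.≤ b v
    far-depth-≤ {v} v∈far with All.lookupAny far-components v∈far
    ... | (K-comp , ¬adj) , v∈K = begin
      depthL Adj forest v  ≡⟨ depthL-there rootTree far (far-∉Kᵣ (K-comp , ¬adj) v∈K) ⟩
      depthL Adj far v     ≡⟨ depthL-filter (¬? ∘ adjacentToRoot?) gs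
                                 (All.map nonadjacent (Allₚ.map⁻ gs-components)) ⟩
      depthL Adj gs v      ≤⟨ gs-depth-≤ (component⇒⊆ K-comp v∈K) ⟩
      b v                  ∎
      where
        open ℕₚ.≤-Reasoning
        nonadjacent : ∀ {K′} → IsComponent Adj K′ (C - r) → v ∈ K′ → ¬ AdjacentToRoot K′
        nonadjacent K′-comp v∈K′ (k , k∈K′ , k~r) =
          ¬adj (k , component-⊆ K′-comp K-comp v∈K′ v∈K k∈K′ , k~r)

    -- The decision is an argument so that matching on it does not abstract
    -- the occurrence of v ≟ r inside depth Adj rootTree v.
    depth-≤ : ∀ {v} → v ∈ C → (v≟r : Dec (v ≡ r)) →
              depthL Adj forest v ℕ.≤ (if does v≟r then 1 else suc (b v))
    depth-≤ v∈C (yes refl) =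
      ℕₚ.≤-reflexive (trans (depthL-here rootTree far r∈Kᵣ) (depth-root rootTree))
    depth-≤ v∈C (no v≢r) with near-or-far (x∈p∧x≢y⇒x∈p-y v∈C v≢r)
    ... | inj₁ v∈near = near-depth-≤ v≢r v∈near
    ... | inj₂ v∈far  = ℕₚ.m≤n⇒m≤1+n (far-depth-≤ v∈far)

    result : Restriction C (λ v → if does (v ≟ r) then 1 else suc (b v))
    result = restriction forest components (λ {v} v∈C → depth-≤ v∈C (v ≟ r))

  mutual
    restrict : ∀ {S} (T : STT Adj S) {C} → C ⊆ S → Restriction C (depth Adj T)
    restrict {S} (node r r∈S ts ts-comps) {C} C⊆S with r ∈? C
    ... | yes r∈C = AttachRoot.result r∈C (restrictComponents ts ts-comps (p⊆q⇒p-x⊆q-x C⊆S))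
    ... | no r∉C  = restriction-mono below-root (restrictComponents ts ts-comps C⊆S-r)
      where
        ∈C⇒≢r : ∀ {v} → v ∈ C → v ≢ r
        ∈C⇒≢r v∈C refl = r∉C v∈C

        C⊆S-r : C ⊆ S - r
        C⊆S-r v∈C = x∈p∧x≢y⇒x∈p-y (C⊆S v∈C) (∈C⇒≢r v∈C)

        below-root : ∀ {v} → v ∈ C → depthL Adj ts v ℕ.≤ depth Adj (node r r∈S ts ts-comps) v
        below-root v∈C = ℕₚ.≤-trans (ℕₚ.n≤1+n _)
          (ℕₚ.≤-reflexive (sym (depth-nonroot (node r r∈S ts ts-comps) (∈C⇒≢r v∈C))))

    restrictComponents : ∀ {S W} ts → AreComponents Adj S (domains ts) → W ⊆ S →
                         Restriction W (depthL Adj ts)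
    restrictComponents ts (ts-comps , ts-cover , _) W⊆S =
      restrictForest ts (All-Closed-⊆ W⊆S (All-component⇒closed ts-comps))
                        (λ v∈W → ts-cover (W⊆S v∈W))

    restrictForest : ∀ {W} ts → All (λ D → Closed D W) (domains ts) →
                     (∀ {v} → v ∈ W → Any (v ∈_) (domains ts)) →
                     Restriction W (depthL Adj ts)
    restrictForest []                 _                      cover =
      restriction [] ([] , cover , []) (λ _ → ℕ.z≤n)
    restrictForest {W} ((D , t) ∷ ts) (D-closed ∷ ts-closed) cover =
      restriction-++ D-closed
        (restrict t (λ v∈W∩D → proj₂ (x∈p∩q⁻ W D v∈W∩D)))
        (restrictForest ts (All-Closed-⊆ (p─q⊆p W D) ts-closed) cover′)
      where
        cover′ : ∀ {v} → v ∈ W ─ D → Any (v ∈_) (domains ts)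
        cover′ v∈W─D with cover (p─q⊆p W D v∈W─D)
        ... | here v∈D  = contradiction v∈D (x∈p─q⇒x∉q v∈W─D)
        ... | there v∈ts = v∈ts

  restrictAwayFrom : ∀ i (T : STT Adj ⊤) → Restriction (⊤ - i) (depth Adj T)
  restrictAwayFrom i T = restrict T (λ _ → ∈⊤)

  rerootAt : Fin n → STT Adj ⊤ → STT Adj ⊤
  rerootAt i T = node i ∈⊤ forest components
    where open Restriction (restrictAwayFrom i T)

  rerootAt-depth-root : ∀ i T → depth Adj (rerootAt i T) i ≡ 1
  rerootAt-depth-root i T = depth-root (rerootAt i T)

  rerootAt-depth-≤ : ∀ i T {v} → v ≢ i → depth Adj (rerootAt i T) v ℕ.≤ suc (depth Adj T v)
  rerootAt-depth-≤ i T {v} v≢i = begin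
    depth Adj (rerootAt i T) v  ≡⟨ depth-nonroot (rerootAt i T) v≢i ⟩
    suc (depthL Adj forest v)   ≤⟨ ℕ.s≤s (depth-≤ (x∈p∧x≢y⇒x∈p-y ∈⊤ v≢i)) ⟩
    suc (depth Adj T v)         ∎
    where
      open Restriction (restrictAwayFrom i T)
      open ℕₚ.≤-Reasoning

ℕ→ℚ≡mkℚ : ∀ d → ℕ→ℚ d ≡ mkℚ (ℤ.+ d) 0 (Coprimality.sym (Coprimality.1-coprimeTo d))
ℕ→ℚ≡mkℚ d = normalize-coprime _

ℕ→ℚ-+ : ∀ a b → ℕ→ℚ (a ℕ.+ b) ≡ ℕ→ℚ a + ℕ→ℚ b
ℕ→ℚ-+ a b rewrite ℕ→ℚ≡mkℚ a | ℕ→ℚ≡mkℚ b =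
  cong (_/ 1) (sym (cong₂ ℤ._+_ (ℤₚ.*-identityʳ (ℤ.+ a)) (ℤₚ.*-identityʳ (ℤ.+ b))))

ℕ→ℚ-nonNeg : ∀ d → 0ℚ ≤ ℕ→ℚ d
ℕ→ℚ-nonNeg d = nonNegative⁻¹ (ℕ→ℚ d) {{normalize-nonNeg d 1}}

ℕ→ℚ-mono-≤ : ∀ {a b} → a ℕ.≤ b → ℕ→ℚ a ≤ ℕ→ℚ b
ℕ→ℚ-mono-≤ {a} {b} a≤b = begin
  ℕ→ℚ a                       ≡⟨ +-identityʳ (ℕ→ℚ a) ⟨
  ℕ→ℚ a + 0ℚ                  ≤⟨ +-monoʳ-≤ (ℕ→ℚ a) (ℕ→ℚ-nonNeg (b ℕ.∸ a)) ⟩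
  ℕ→ℚ a + ℕ→ℚ (b ℕ.∸ a)       ≡⟨ ℕ→ℚ-+ a (b ℕ.∸ a) ⟨
  ℕ→ℚ (a ℕ.+ (b ℕ.∸ a))       ≡⟨ cong ℕ→ℚ (ℕₚ.m+[n∸m]≡n a≤b) ⟩
  ℕ→ℚ b                       ∎
  where open ≤-Reasoning

Σᵥ-cong : ∀ {n} {g h : Fin n → ℚ} → (∀ v → g v ≡ h v) → Σᵥ g ≡ Σᵥ h
Σᵥ-cong {zero}  g≡h = refl
Σᵥ-cong {suc n} g≡h = cong₂ _+_ (g≡h zero) (Σᵥ-cong (g≡h ∘ suc))

Σᵥ-mono-≤ : ∀ {n} {g h : Fin n → ℚ} → (∀ v → g v ≤ h v) → Σᵥ g ≤ Σᵥ h
Σᵥ-mono-≤ {zero}  g≤h = ≤-refl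
Σᵥ-mono-≤ {suc n} g≤h = +-mono-≤ (g≤h zero) (Σᵥ-mono-≤ (g≤h ∘ suc))

Σᵥ-+ : ∀ {n} (g h : Fin n → ℚ) → Σᵥ (λ v → g v + h v) ≡ Σᵥ g + Σᵥ h
Σᵥ-+ {zero}  g h = refl
Σᵥ-+ {suc n} g h = trans (cong ((g zero + h zero) +_) (Σᵥ-+ (g ∘ suc) (h ∘ suc)))
                         (interchange (g zero) (h zero) (Σᵥ (g ∘ suc)) (Σᵥ (h ∘ suc)))
  where open CommSemigroupProperties (CommutativeMonoid.commutativeSemigroup +-0-commutativeMonoid)

Σᵥ-0 : ∀ {n} {g : Fin n → ℚ} → (∀ v → g v ≡ 0ℚ) → Σᵥ g ≡ 0ℚ
Σᵥ-0 {zero}  g≡0 = refl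
Σᵥ-0 {suc n} g≡0 = cong₂ _+_ (g≡0 zero) (Σᵥ-0 (g≡0 ∘ suc))

Σᵥ-concentrated : ∀ {n} (g : Fin n → ℚ) i → (∀ v → v ≢ i → g v ≡ 0ℚ) → Σᵥ g ≡ g i
Σᵥ-concentrated {suc n} g zero    g≡0 =
  trans (cong (g zero +_) (Σᵥ-0 (λ v → g≡0 (suc v) λ ()))) (+-identityʳ (g zero))
Σᵥ-concentrated {suc n} g (suc i) g≡0 =
  trans (cong₂ _+_ (g≡0 zero λ ())
                    (Σᵥ-concentrated (g ∘ suc) i (λ v v≢i → g≡0 (suc v) (v≢i ∘ suc-injective))))
        (+-identityˡ (g (suc i)))

weightedSum : ∀ {n} → (Fin n → ℚ) → (Fin n → ℕ) → ℚ
weightedSum f a = Σᵥ (λ v → f v * ℕ→ℚ (a v))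

weightedSum-+ : ∀ {n} (f : Fin n → ℚ) (a b : Fin n → ℕ) →
                weightedSum f (λ v → a v ℕ.+ b v) ≡ weightedSum f a + weightedSum f b
weightedSum-+ f a b = trans
  (Σᵥ-cong (λ v → trans (cong (f v *_) (ℕ→ℚ-+ (a v) (b v)))
                        (*-distribˡ-+ (f v) (ℕ→ℚ (a v)) (ℕ→ℚ (b v)))))
  (Σᵥ-+ (λ v → f v * ℕ→ℚ (a v)) (λ v → f v * ℕ→ℚ (b v)))

weightedSum-mono-≤ : ∀ {n} (f : Fin n → ℚ) → (∀ v → 0ℚ ≤ f v) → {a b : Fin n → ℕ} →
                     (∀ v → a v ℕ.≤ b v) → weightedSum f a ≤ weightedSum f b
weightedSum-mono-≤ f f≥0 a≤b =
  Σᵥ-mono-≤ (λ v → *-monoˡ-≤-nonNeg (f v) {{nonNegative (f≥0 v)}} (ℕ→ℚ-mono-≤ (a≤b v)))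

weightedSum-1 : ∀ {n} (f : Fin n → ℚ) → weightedSum f (λ _ → 1) ≡ Σᵥ f
weightedSum-1 f = Σᵥ-cong (λ v → *-identityʳ (f v))

weightedSum-point : ∀ {n} (f : Fin n → ℚ) i d →
                    weightedSum f (λ v → if does (v ≟ i) then d else 0) ≡ f i * ℕ→ℚ d
weightedSum-point f i d = trans
  (Σᵥ-concentrated _ i λ v v≢i →
    trans (cong (λ b → f v * ℕ→ℚ (if b then d else 0)) (dec-false (v ≟ i) v≢i)) (*-zeroʳ (f v)))
  (cong (λ b → f i * ℕ→ℚ (if b then d else 0)) (dec-true (i ≟ i) refl))

weightedSum-reroot : ∀ {n} (f : Fin n → ℚ) → (∀ v → 0ℚ ≤ f v) → ∀ i (a a′ : Fin n → ℕ) →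
                     a′ i ≡ 1 → (∀ {v} → v ≢ i → a′ v ℕ.≤ suc (a v)) →
                     weightedSum f a′ + f i * ℕ→ℚ (a i) ≤ weightedSum f a + Σᵥ f
weightedSum-reroot {n} f f≥0 i a a′ a′i≡1 a′≤1+a = begin
  weightedSum f a′ + f i * ℕ→ℚ (a i)
    ≡⟨ cong (weightedSum f a′ +_) (weightedSum-point f i (a i)) ⟨
  weightedSum f a′ + weightedSum f point      ≡⟨ weightedSum-+ f a′ point ⟨
  weightedSum f (λ v → a′ v ℕ.+ point v)      ≤⟨ weightedSum-mono-≤ f f≥0 pointwise ⟩
  weightedSum f (λ v → a v ℕ.+ 1)             ≡⟨ weightedSum-+ f a (λ _ → 1) ⟩
  weightedSum f a + weightedSum f (λ _ → 1)   ≡⟨ cong (weightedSum f a +_) (weightedSum-1 f) ⟩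
  weightedSum f a + Σᵥ f                      ∎
  where
    open ≤-Reasoning
    point : Fin n → ℕ
    point v = if does (v ≟ i) then a i else 0

    pointwise : ∀ v → a′ v ℕ.+ point v ℕ.≤ a v ℕ.+ 1
    pointwise v with v ≟ i
    ... | yes refl =
          subst (λ d → d ℕ.+ a v ℕ.≤ a v ℕ.+ 1) (sym a′i≡1) (ℕₚ.≤-reflexive (ℕₚ.+-comm 1 (a v)))
    ... | no v≢i   = subst₂ ℕ._≤_ (sym (ℕₚ.+-identityʳ (a′ v))) (ℕₚ.+-comm 1 (a v)) (a′≤1+a v≢i)

+-cancelˡ-≤ : ∀ r {p q} → r + p ≤ r + q → p ≤ q
+-cancelˡ-≤ r {p} {q} r+p≤r+q = subst₂ _≤_ (cancel p) (cancel q) (+-monoʳ-≤ (- r) r+p≤r+q)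
  where
    cancel : ∀ x → - r + (r + x) ≡ x
    cancel x = trans (sym (+-assoc (- r) r x)) (trans (cong (_+ x) (+-inverseˡ r)) (+-identityˡ x))

*≤1⇒≤1/ : ∀ p q (q>0 : 0ℚ < q) → q * p ≤ 1ℚ → p ≤ (1/ q) {{pos⇒nonZero q {{positive q>0}}}}
*≤1⇒≤1/ p q q>0 qp≤1 = *-cancelˡ-≤-pos q {{positive q>0}}
  (subst (q * p ≤_) (sym (*-inverseʳ q {{pos⇒nonZero q {{positive q>0}}}})) qp≤1)

lemma3p4 : ∀ {n : ℕ} (Adj : Fin n → Fin n → Set) → IsTree Adj →
    (f : Fin n → ℚ) → (∀ v → 0ℚ ≤ f v) → Σᵥ f ≡ 1ℚ →
    (i : Fin n) → (fi>0 : 0ℚ < f i) →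
    (T : STT Adj ⊤) → (∀ (T′ : STT Adj ⊤) → cost Adj T f ≤ cost Adj T′ f) →
    ℕ→ℚ (depth Adj T i) ≤ (1/ f i) {{pos⇒nonZero (f i) {{positive fi>0}}}}
lemma3p4 Adj tree f f≥0 Σf≡1 i fi>0 T T-optimal =
  *≤1⇒≤1/ d (f i) fi>0 (+-cancelˡ-≤ (cost Adj T f) (begin
    cost Adj T f + f i * d   ≤⟨ +-monoˡ-≤ (f i * d) (T-optimal T′) ⟩
    cost Adj T′ f + f i * d  ≤⟨ weightedSum-reroot f f≥0 i (depth Adj T) (depth Adj T′)
                                  (rerootAt-depth-root i T) (rerootAt-depth-≤ i T) ⟩
    cost Adj T f + Σᵥ f      ≡⟨ cong (cost Adj T f +_) Σf≡1 ⟩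
    cost Adj T f + 1ℚ        ∎))
  where
    open Restrictions Adj (IsTree.sym tree) (Paths.IsTree⇒adj? Adj tree)
    open ≤-Reasoning

    d : ℚ
    d = ℕ→ℚ (depth Adj T i)

    T′ : STT Adj ⊤
    T′ = rerootAt i T
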